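{- Let $k$ be a positive integer and $G$ a graph. (1) If $G$ contains a Hamiltonian cycle $C$ such that $G-E(C)\in\mathcal{SZ}_k$, then $G\in\mathcal{SC}_k$. (2) If for any two distinct vertices $x,y$ of $G$ there is a Hamiltonian path $P_{xy}$ with endpoints $x$ and $y$ such that $G-E(P_{xy})\in\mathcal{SZ}_k$, then $G\in\mathcal{W}_k$.
   Context: Graphs may have parallel edges but no loops. A $\mathbb{Z}_k$-boundary of $G$ is a map $\beta:V(G)\to\mathbb{Z}_k$ with $\sum_v\beta(v)\equiv0\pmod k$; a $(\mathbb{Z}_k,\beta)$-orientation is an orientation $D$ with $d^+_D(v)-d^-_D(v)\equiv\beta(v)\pmod k$ for all $v$. $\mathcal{SZ}_k$ is the family of graphs (strongly $\mathbb{Z}_k$-connected graphs) having a $(\mathbb{Z}_k,\beta)$-orientation for every $\mathbb{Z}_k$-boundary $\beta$. A $\mathbb{Z}_{2k}$-pc-boundary of $G$ is a map $\beta:V(G)\to\{0,\pm1,\dots,\pm k\}$ with $\beta(v)\equiv d(v)\pmod 2$ and $\sum_v\beta(v)\equiv0\pmod{2k}$; a $(2k,\beta)$-orientation is an orientation $D$ with $d^+_D(v)-d^-_D(v)\equiv\beta(v)\pmod{2k}$ for all $v$. An orientation is strongly connected if every nonempty proper vertex subset has at least one out-going and one in-coming edge. $\mathcal{SC}_k$ is the family of graphs that have a strongly connected $(2k,\beta)$-orientation for every $\mathbb{Z}_{2k}$-pc-boundary $\beta$. A graph $G$ is a nice supergraph of $H$ if $H\subseteq G$ and $G-E(H)$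 contains a path between two distinct vertices of $H$. For a connected subgraph $H$ of $G$, with $w$ the vertex of $G/H$ obtained by contracting $H$, and a $\mathbb{Z}_{2k}$-pc-boundary $\beta$ of $G$, let $\beta'$ on $V(G/H)$ be given by $\beta'(w)\equiv\sum_{v\in V(H)}\beta(v)\pmod{2k}$ (taken in $\{0,\pm1,\dots,\pm k\}$) and $\beta'(v)=\beta(v)$ otherwise. A graph $H$ is weakly contractible if for every nice supergraph $G$ of $H$ and every $\mathbb{Z}_{2k}$-pc-boundary $\beta$ of $G$, every strongly connected $(2k,\beta')$-orientation of $G/H$ extends (by orienting the edges of $H$) to a strongly connected $(2k,\beta)$-orientation of $G$. $\mathcal{W}_k$ is the family of weakly contractible graphs. -}

module Defs where

open import Data.Nat as ℕ using (ℕ; zero; suc; _≤_)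
open import Data.Fin as Fin using (Fin; zero; suc; toℕ; inject₁; fromℕ)
open import Data.Integer as ℤ using (ℤ; +_; _-_; ∣_∣) renaming (_+_ to _+ℤ_; _*_ to _*ℤ_)
open import Data.Integer.Divisibility using () renaming (_∣_ to _∣ℤ_)
open import Data.Bool using (Bool; true; false)
open import Data.Product using (Σ; ∃; ∃-syntax; _×_; _,_; proj₁; proj₂)
open import Data.Sum using (_⊎_)
open import Data.List as List using (List; []; _∷_; _++_; length; filter; allFin; foldr; tabulate)
open import Data.List.Relation.Unary.All using (All)
open import Data.List.Relation.Unary.Any using (Any)
open import Data.List.Relation.Binary.Pointwise using (Pointwise)
open import Data.List.Relation.Binary.Permutation.Propositional using (_↭_)
open import Function.Definitions using (Bijective; Injective)
open import Relation.Binary.PropositionalEquality using (_≡_; _≢_)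
open import Relation.Nullary using (¬_; ¬?)

-- Multigraphs on vertex set Fin n: the edge multiset is a list of
-- (unordered) edges, each recorded as a pair of endpoints.

Edge : ℕ → Set
Edge n = Fin n × Fin n

Graph : ℕ → Set
Graph n = List (Edge n)

Loopless : ∀ {n} → Graph n → Set
Loopless G = All (λ e → proj₁ e ≢ proj₂ e) G

Joins : ∀ {n} → Fin n → Fin n → Edge n → Set
Joins a b e = e ≡ (a , b) ⊎ e ≡ (b , a)

-- Orientations: D is a list of arcs (tail , head), the i-th arc being the
-- i-th edge of G oriented one of the two ways.

IsOrientation : ∀ {n} → Graph n → List (Edge n) → Set
IsOrientation G D = Pointwise (λ e d → Joins (proj₁ e) (proj₂ e) d) G D

outdeg : ∀ {n} → List (Edge n) → Fin n → ℕ
outdeg D v = length (filter (λ d → proj₁ d Fin.≟ v) D)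

indeg : ∀ {n} → List (Edge n) → Fin n → ℕ
indeg D v = length (filter (λ d → proj₂ d Fin.≟ v) D)

net : ∀ {n} → List (Edge n) → Fin n → ℤ
net D v = + outdeg D v - + indeg D v

deg : ∀ {n} → Graph n → Fin n → ℕ
deg G v = outdeg G v ℕ.+ indeg G v

Σℤ : ∀ {n} → (Fin n → ℤ) → ℤ
Σℤ {n} f = foldr _+ℤ_ (+ 0) (List.map f (allFin n))

IsZkBoundary : ∀ (k : ℕ) {n} → (Fin n → Fin k) → Set
IsZkBoundary k β = (+ k) ∣ℤ Σℤ (λ v → + toℕ (β v))

IsZkOrientation : ∀ (k : ℕ) {n} → Graph n → (Fin n → Fin k) → List (Edge n) → Set
IsZkOrientation k G β D =
  IsOrientation G D × (∀ v → (+ k) ∣ℤ (net D v - + toℕ (β v)))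

SZ : ℕ → ∀ {n} → Graph n → Set
SZ k {n} G = ∀ (β : Fin n → Fin k) → IsZkBoundary k β →
  ∃[ D ] IsZkOrientation k G β D

IsPcBoundary : ∀ (k : ℕ) {n} → Graph n → (Fin n → ℤ) → Set
IsPcBoundary k G β =
  (∀ v → ∣ β v ∣ ≤ k) ×
  (∀ v → (+ 2) ∣ℤ (β v - + deg G v)) ×
  ((+ (2 ℕ.* k)) ∣ℤ Σℤ β)

Mod2k : ∀ (k : ℕ) {n} → (Fin n → ℤ) → List (Edge n) → Set
Mod2k k β D = ∀ v → (+ (2 ℕ.* k)) ∣ℤ (net D v - β v)

IsStronglyConnected : ∀ {n} → List (Edge n) → Set
IsStronglyConnected {n} D =
  ∀ (S : Fin n → Bool) → (∃[ v ] S v ≡ true) → (∃[ v ] S v ≡ false) →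
    Any (λ d → S (proj₁ d) ≡ true × S (proj₂ d) ≡ false) D ×
    Any (λ d → S (proj₁ d) ≡ false × S (proj₂ d) ≡ true) D

SC : ℕ → ∀ {n} → Graph n → Set
SC k {n} G = ∀ (β : Fin n → ℤ) → IsPcBoundary k G β →
  ∃[ D ] (IsOrientation G D × IsStronglyConnected D × Mod2k k β D)

-- cyclic successor on Fin (suc m): i ↦ i+1, last ↦ 0
cnext : ∀ {m} → Fin (suc m) → Fin (suc m)
cnext {zero} zero = zero
cnext {suc m} zero = suc zero
cnext {suc m} (suc i) with cnext i
... | zero = zero
... | suc j = suc (suc j)

-- A Hamiltonian cycle of length len+2 ≥ 2 on vertex set Fin n:
-- a cyclic ordering of all vertices and the edges joining consecutive ones.
record HamCycle (n : ℕ) : Set where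
  field
    len   : ℕ
    vert  : Fin (suc (suc len)) → Fin n
    vbij  : Bijective _≡_ _≡_ vert
    edge  : Fin (suc (suc len)) → Edge n
    joins : ∀ i → Joins (vert i) (vert (cnext i)) (edge i)

cycleEdges : ∀ {n} → HamCycle n → List (Edge n)
cycleEdges C = tabulate (HamCycle.edge C)

record HamPath (n : ℕ) (x y : Fin n) : Set where
  field
    len   : ℕ
    vert  : Fin (suc len) → Fin n
    vbij  : Bijective _≡_ _≡_ vert
    start : vert zero ≡ x
    end   : vert (fromℕ len) ≡ y
    edge  : Fin len → Edge n
    joins : ∀ i → Joins (vert (inject₁ i)) (vert (suc i)) (edge i)

pathEdges : ∀ {n} {x y : Fin n} → HamPath n x y → List (Edge n)
pathEdges P = tabulate (HamPath.edge P)

record PathIn {n} (R : Graph n) (a b : Fin n) : Set where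
  field
    len   : ℕ
    vert  : Fin (suc len) → Fin n
    vinj  : Injective _≡_ _≡_ vert
    start : vert zero ≡ a
    end   : vert (fromℕ len) ≡ b
    step  : ∀ i → Any (Joins (vert (inject₁ i)) (vert (suc i))) R

mapEdge : ∀ {n m} → (Fin n → Fin m) → Edge n → Edge m
mapEdge f e = f (proj₁ e) , f (proj₂ e)

-- π : Fin n → Fin (suc r) is the contraction map G → G/H, where V(H) is
-- the image of ι: it sends V(H) to the new vertex w = zero and is a
-- bijection from V(G) ∖ V(H) onto the remaining vertices.
IsContractionMap : ∀ {h n r} → (Fin h → Fin n) → (Fin n → Fin (suc r)) → Set
IsContractionMap {h} {n} {r} ι π =
  (∀ v → π v ≡ zero → ∃[ a ] ι a ≡ v) ×
  (∀ a → π (ι a) ≡ zero) ×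
  (∀ u v → π u ≡ π v → π u ≢ zero → u ≡ v) ×
  (∀ (j : Fin (suc r)) → ∃[ v ] π v ≡ j)

contractEdges : ∀ {n r} → (Fin n → Fin (suc r)) → List (Edge n) → List (Edge (suc r))
contractEdges π R =
  List.map (mapEdge π) (filter (λ e → ¬? (π (proj₁ e) Fin.≟ π (proj₂ e))) R)

IsContractedBoundary : ∀ (k : ℕ) {h n r} → (Fin h → Fin n) → (Fin n → Fin (suc r)) →
  (Fin n → ℤ) → (Fin (suc r) → ℤ) → Set
IsContractedBoundary k ι π β β' =
  (∣ β' zero ∣ ≤ k) ×
  ((+ (2 ℕ.* k)) ∣ℤ (β' zero - Σℤ (λ a → β (ι a)))) ×
  (∀ v → π v ≢ zero → β' (π v) ≡ β v)

-- H is weakly contractible: for every nice supergraph G of H (G is given by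
-- an injective vertex embedding ι of H and the list R of edges of G − E(H),
-- so E(G) = ι(E(H)) ++ R), every Z_2k-pc-boundary β of G and every strongly
-- connected (2k,β')-orientation D' of G/H, there is a strongly connected
-- (2k,β)-orientation of G agreeing with D' on the edges of G/H.
W : ℕ → ∀ {h} → Graph h → Set
W k {h} H =
  ∀ (n : ℕ) (ι : Fin h → Fin n) → Injective _≡_ _≡_ ι →
  ∀ (R : Graph n) → Loopless (List.map (mapEdge ι) H ++ R) →
  (∃[ a ] ∃[ b ] (a ≢ b × PathIn R (ι a) (ι b))) →
  ∀ (β : Fin n → ℤ) → IsPcBoundary k (List.map (mapEdge ι) H ++ R) β →
  ∀ (r : ℕ) (π : Fin n → Fin (suc r)) → IsContractionMap ι π →
  ∀ (β' : Fin (suc r) → ℤ) → IsContractedBoundary k ι π β β' →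
  ∀ (D' : List (Edge (suc r))) → IsOrientation (contractEdges π R) D' →
    IsStronglyConnected D' → Mod2k k β' D' →
  ∃[ DH ] ∃[ DR ]
    (IsOrientation (List.map (mapEdge ι) H) DH ×
     IsOrientation R DR ×
     contractEdges π DR ≡ D' ×
     IsStronglyConnected (DH ++ DR) ×
     Mod2k k β (DH ++ DR))

{-# OPTIONS --safe #-}

-- The hypotheses force k to be odd: for even k the parity of any boundary realised by an
-- orientation is fixed by the degrees, so no graph with two vertices lies in SZ_k. For odd k a
-- Z_2k-pc-boundary β is determined modulo 2k by its residue modulo k, because
-- β ≡ deg ≡ d⁺ − d⁻ (mod 2) for every orientation.
--
-- (1) Orient C cyclically, which crosses every cut both ways, and let the SZ_k property of
-- G − E(C) realise β minus the net degrees of C modulo k.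
--
-- (2) Lift the orientation of G/H to G − E(H). As G/H is strongly connected and G − E(H)
-- contains a path between two vertices of H, some vertex a of H is reachable from another
-- vertex b. Orient a Hamiltonian a–b path of H from a to b and let the SZ_k property of the
-- rest of H realise what β still demands on V(H). A cut separating vertices of H is crossed
-- in one direction by the path and in the other by the path or by the route from b back to a;
-- a cut not separating V(H) comes from a cut of G/H.
module Submission where

open import Data.Bool as Bool using (Bool; true; false; not; if_then_else_)
open import Data.Bool.Properties using (¬-not; not-¬; not-injective; not-involutive)
open import Data.Empty using (⊥; ⊥-elim)
open import Data.Fin using (Fin; zero; suc; toℕ; inject₁; fromℕ; fromℕ<; _≟_)
import Data.Fin.Properties as FinP
open import Data.Fin.Subset using (Subset)
open import Data.Fin.Subset.Properties using (anySubset?)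
open import Data.Integer using (ℤ; +_; -_; _-_; _+_; _*_)
import Data.Integer.Divisibility as ℤ∣
import Data.Integer.Divisibility.Signed as Sg
open import Data.Integer.DivMod using (_%ℕ_; _/ℕ_; n%ℕd<d; a≡a%ℕn+[a/ℕn]*n)
import Data.Integer.Properties as ℤP
open import Data.Integer.Tactic.RingSolver using (solve-∀)
open import Data.List as List using (List; []; _∷_; _++_)
import Data.List.Properties as ListP
open import Data.List.Membership.Propositional using (_∈_; find; lose)
open import Data.List.Membership.Propositional.Properties using (∈-map⁺)
open import Data.List.Relation.Binary.Permutation.Propositional as ↭ using (_↭_)
import Data.List.Relation.Binary.Permutation.Propositional.Properties as PermP
open import Data.List.Relation.Binary.Pointwise as Pointwise using (Pointwise; []; _∷_)
open import Data.List.Relation.Unary.Any as Any using (Any; here; there)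
import Data.List.Relation.Unary.Any.Properties as AnyP
open import Data.Nat as ℕ using (ℕ; zero; suc; _≤_; NonZero)
open import Data.Nat.Divisibility as ℕ∣ using (divides)
open import Data.Nat.Primality using (euclidsLemma; prime[2])
import Data.Nat.Properties as ℕP
import Data.Nat.Tactic.RingSolver as ℕSolver
open import Data.Product using (∃; ∃-syntax; _×_; _,_; proj₁; proj₂)
open import Data.Sum as Sum using (_⊎_; inj₁; inj₂)
import Data.Vec as Vec
import Data.Vec.Properties as VecP
open import Function using (_∘_)
open import Function.Bundles using (_⇔_; mk⇔)
open import Function.Definitions using (Bijective; Injective)
open import Relation.Binary using (Setoid; IsEquivalence)
open import Relation.Binary.PropositionalEquality as ≡ using (_≡_; _≢_; refl; cong; cong₂)
open import Relation.Nullary using (¬_; ¬?; Dec; yes; no; does)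
open import Relation.Nullary.Decidable as Dec using (dec-true; dec-false; does-⇔; _×-dec_)
open import Relation.Unary using (Decidable)

open import Defs

-- Congruences of integers

infix 4 _≡_mod_

-- A record rather than a synonym for divisibility, so that a and b can be inferred.
record _≡_mod_ (a b : ℤ) (m : ℕ) : Set where
  constructor mod-by
  field
    divides-difference : + m Sg.∣ (a - b)

open _≡_mod_ public

module _ {m : ℕ} where

  ≡⇒≡-mod : ∀ {a b} → a ≡ b → a ≡ b mod m
  ≡⇒≡-mod {a} refl = mod-by (Sg.divides (+ 0) (ℤP.+-inverseʳ a))

  ≡-mod-sym : ∀ {a b} → a ≡ b mod m → b ≡ a mod m
  ≡-mod-sym {a} {b} (mod-by m∣a-b) = mod-by (≡.subst (+ m Sg.∣_) (flip a b) (Sg.∣m⇒∣-m m∣a-b))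
    where
    flip : ∀ a b → - (a - b) ≡ b - a
    flip = solve-∀

  ≡-mod-trans : ∀ {a b c} → a ≡ b mod m → b ≡ c mod m → a ≡ c mod m
  ≡-mod-trans {a} {b} {c} (mod-by m∣a-b) (mod-by m∣b-c) =
    mod-by (≡.subst (+ m Sg.∣_) (chain a b c) (Sg.∣m∣n⇒∣m+n m∣a-b m∣b-c))
    where
    chain : ∀ a b c → (a - b) + (b - c) ≡ a - c
    chain = solve-∀

  +-cong-mod : ∀ {a b c d} → a ≡ b mod m → c ≡ d mod m → a + c ≡ b + d mod m
  +-cong-mod {a} {b} {c} {d} (mod-by m∣a-b) (mod-by m∣c-d) =
    mod-by (≡.subst (+ m Sg.∣_) (regroup a b c d) (Sg.∣m∣n⇒∣m+n m∣a-b m∣c-d))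
    where
    regroup : ∀ a b c d → (a - b) + (c - d) ≡ (a + c) - (b + d)
    regroup = solve-∀

  -‿cong-mod : ∀ {a b c d} → a ≡ b mod m → c ≡ d mod m → a - c ≡ b - d mod m
  -‿cong-mod {a} {b} {c} {d} (mod-by m∣a-b) (mod-by m∣c-d) =
    mod-by (≡.subst (+ m Sg.∣_) (regroup a b c d) (Sg.∣m∣n⇒∣m-n m∣a-b m∣c-d))
    where
    regroup : ∀ a b c d → (a - b) - (c - d) ≡ (a - c) - (b - d)
    regroup = solve-∀

  +-congˡ-mod : ∀ a {c d} → c ≡ d mod m → a + c ≡ a + d mod m
  +-congˡ-mod a = +-cong-mod (≡⇒≡-mod {a} refl)

  +-congʳ-mod : ∀ c {a b} → a ≡ b mod m → a + c ≡ b + c mod m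
  +-congʳ-mod c a≡b = +-cong-mod a≡b (≡⇒≡-mod {c} refl)

  ≡-mod-isEquivalence : IsEquivalence (λ a b → a ≡ b mod m)
  ≡-mod-isEquivalence = record
    { refl  = ≡⇒≡-mod refl
    ; sym   = ≡-mod-sym
    ; trans = ≡-mod-trans
    }

≡-mod-setoid : ℕ → Setoid _ _
≡-mod-setoid m = record { isEquivalence = ≡-mod-isEquivalence {m} }

module mod-Reasoning (m : ℕ) where
  open import Relation.Binary.Reasoning.Setoid (≡-mod-setoid m) public

-- Defs expresses divisibility of integers through absolute values (ℤ∣).
∣ᵤ⇒≡-mod : ∀ {m} a b → + m ℤ∣.∣ (a - b) → a ≡ b mod m
∣ᵤ⇒≡-mod a b m∣a-b = mod-by (Sg.∣ᵤ⇒∣ m∣a-b)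

≡-mod⇒∣ᵤ : ∀ {m a b} → a ≡ b mod m → + m ℤ∣.∣ (a - b)
≡-mod⇒∣ᵤ (mod-by m∣a-b) = Sg.∣⇒∣ᵤ m∣a-b

∣ᵤ⇒≡0-mod : ∀ {m} a → + m ℤ∣.∣ a → a ≡ + 0 mod m
∣ᵤ⇒≡0-mod {m} a m∣a = ∣ᵤ⇒≡-mod a (+ 0) (≡.subst (+ m ℤ∣.∣_) (≡.sym (ℤP.+-identityʳ a)) m∣a)

≡0-mod⇒∣ᵤ : ∀ {m a} → a ≡ + 0 mod m → + m ℤ∣.∣ a
≡0-mod⇒∣ᵤ {m} {a} a≡0 = ≡.subst (+ m ℤ∣.∣_) (ℤP.+-identityʳ a) (≡-mod⇒∣ᵤ a≡0)

≡-mod-∣ : ∀ {m m′ a b} → m ℕ∣.∣ m′ → a ≡ b mod m′ → a ≡ b mod m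
≡-mod-∣ m∣m′ (mod-by m′∣a-b) = mod-by (Sg.∣-trans (Sg.∣ᵤ⇒∣ m∣m′) m′∣a-b)

∣∧2∣⇒2*∣ : ∀ {k n} → ¬ 2 ℕ∣.∣ k → k ℕ∣.∣ n → 2 ℕ∣.∣ n → 2 ℕ.* k ℕ∣.∣ n
∣∧2∣⇒2*∣ {k} 2∤k (divides q refl) 2∣q*k with euclidsLemma q k prime[2] 2∣q*k
... | inj₁ (divides q′ refl) = divides q′ (ℕP.*-assoc q′ 2 k)
... | inj₂ 2∣k = ⊥-elim (2∤k 2∣k)

≡-mod-2* : ∀ {k a b} → ¬ 2 ℕ∣.∣ k → a ≡ b mod k → a ≡ b mod 2 → a ≡ b mod (2 ℕ.* k)
≡-mod-2* 2∤k (mod-by k∣a-b) (mod-by 2∣a-b) =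
  mod-by (Sg.∣ᵤ⇒∣ (∣∧2∣⇒2*∣ 2∤k (Sg.∣⇒∣ᵤ k∣a-b) (Sg.∣⇒∣ᵤ 2∣a-b)))

odd⇒nonZero : ∀ {k} → ¬ 2 ℕ∣.∣ k → NonZero k
odd⇒nonZero {zero}  2∤0 = ⊥-elim (2∤0 (2 ℕ∣.∣0))
odd⇒nonZero {suc k} _   = _

residue : ∀ k .{{_ : NonZero k}} (z : ℤ) → ∃[ g ] + toℕ {k} g ≡ z mod k
residue k z = fromℕ< (n%ℕd<d z k) , mod-by (Sg.divides (- (z /ℕ k)) (begin
  + toℕ (fromℕ< (n%ℕd<d z k)) - z
    ≡⟨ cong (λ r → + r - z) (FinP.toℕ-fromℕ< (n%ℕd<d z k)) ⟩
  + (z %ℕ k) - z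
    ≡⟨ cong (λ z′ → + (z %ℕ k) - z′) (a≡a%ℕn+[a/ℕn]*n z k) ⟩
  + (z %ℕ k) - (+ (z %ℕ k) + (z /ℕ k) * + k)
    ≡⟨ cancel (+ (z %ℕ k)) (z /ℕ k) (+ k) ⟩
  - (z /ℕ k) * + k ∎))
  where
  open ≡.≡-Reasoning
  cancel : ∀ r q k → r - (r + q * k) ≡ - q * k
  cancel = solve-∀

-- Sums over the vertex set

Σℤ-suc : ∀ {n} (f : Fin (suc n) → ℤ) → Σℤ f ≡ f zero + Σℤ (f ∘ suc)
Σℤ-suc f = cong (λ xs → f zero + List.foldr _+_ (+ 0) xs)
  (≡.trans (ListP.map-tabulate suc f) (≡.sym (ListP.map-tabulate (λ i → i) (f ∘ suc))))

Σℤ-cong : ∀ {n} {f g : Fin n → ℤ} → (∀ i → f i ≡ g i) → Σℤ f ≡ Σℤ g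
Σℤ-cong {zero}          f≗g = refl
Σℤ-cong {suc n} {f} {g} f≗g = begin
  Σℤ f                    ≡⟨ Σℤ-suc f ⟩
  f zero + Σℤ (f ∘ suc)   ≡⟨ cong₂ _+_ (f≗g zero) (Σℤ-cong (f≗g ∘ suc)) ⟩
  g zero + Σℤ (g ∘ suc)   ≡⟨ Σℤ-suc g ⟨
  Σℤ g                    ∎
  where open ≡.≡-Reasoning

Σℤ-0 : ∀ n → Σℤ {n} (λ _ → + 0) ≡ + 0
Σℤ-0 zero    = refl
Σℤ-0 (suc n) = ≡.trans (Σℤ-suc {n} (λ _ → + 0)) (≡.trans (ℤP.+-identityˡ _) (Σℤ-0 n))

Σℤ-+ : ∀ {n} (f g : Fin n → ℤ) → Σℤ (λ i → f i + g i) ≡ Σℤ f + Σℤ g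
Σℤ-+ {zero}  f g = refl
Σℤ-+ {suc n} f g = begin
  Σℤ (λ i → f i + g i)
    ≡⟨ Σℤ-suc (λ i → f i + g i) ⟩
  (f zero + g zero) + Σℤ (λ i → f (suc i) + g (suc i))
    ≡⟨ cong (_+_ (f zero + g zero)) (Σℤ-+ (f ∘ suc) (g ∘ suc)) ⟩
  (f zero + g zero) + (Σℤ (f ∘ suc) + Σℤ (g ∘ suc))
    ≡⟨ interchange (f zero) (g zero) (Σℤ (f ∘ suc)) (Σℤ (g ∘ suc)) ⟩
  (f zero + Σℤ (f ∘ suc)) + (g zero + Σℤ (g ∘ suc))
    ≡⟨ cong₂ _+_ (Σℤ-suc f) (Σℤ-suc g) ⟨
  Σℤ f + Σℤ g ∎
  where
  open ≡.≡-Reasoning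
  interchange : ∀ a b c d → (a + b) + (c + d) ≡ (a + c) + (b + d)
  interchange = solve-∀

Σℤ-neg : ∀ {n} (f : Fin n → ℤ) → Σℤ (λ i → - f i) ≡ - Σℤ f
Σℤ-neg {zero}  f = refl
Σℤ-neg {suc n} f = begin
  Σℤ (λ i → - f i)              ≡⟨ Σℤ-suc (λ i → - f i) ⟩
  - f zero + Σℤ (λ i → - f (suc i)) ≡⟨ cong (_+_ (- f zero)) (Σℤ-neg (f ∘ suc)) ⟩
  - f zero + - Σℤ (f ∘ suc)     ≡⟨ ℤP.neg-distrib-+ (f zero) _ ⟨
  - (f zero + Σℤ (f ∘ suc))     ≡⟨ cong -_ (Σℤ-suc f) ⟨
  - Σℤ f                        ∎
  where open ≡.≡-Reasoning

Σℤ-- : ∀ {n} (f g : Fin n → ℤ) → Σℤ (λ i → f i - g i) ≡ Σℤ f - Σℤ g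
Σℤ-- f g = ≡.trans (Σℤ-+ f (λ i → - g i)) (cong (_+_ (Σℤ f)) (Σℤ-neg g))

Σℤ-cong-mod : ∀ {m n} {f g : Fin n → ℤ} → (∀ i → f i ≡ g i mod m) → Σℤ f ≡ Σℤ g mod m
Σℤ-cong-mod {m} {zero}          f≡g = ≡⇒≡-mod refl
Σℤ-cong-mod {m} {suc n} {f} {g} f≡g = begin
  Σℤ f                    ≡⟨ Σℤ-suc f ⟩
  f zero + Σℤ (f ∘ suc)   ≈⟨ +-cong-mod (f≡g zero) (Σℤ-cong-mod (f≡g ∘ suc)) ⟩
  g zero + Σℤ (g ∘ suc)   ≡⟨ Σℤ-suc g ⟨
  Σℤ g                    ∎
  where open mod-Reasoning m

-- Defined via does, so that δ (suc u) (suc v) reduces to δ u v.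
δ : ∀ {n} → Fin n → Fin n → ℕ
δ u v = if does (u ≟ v) then 1 else 0

δ-refl : ∀ {n} (u : Fin n) → δ u u ≡ 1
δ-refl u = cong (λ b → if b then 1 else 0) (dec-true (u ≟ u) refl)

δ-≢ : ∀ {n} {u v : Fin n} → u ≢ v → δ u v ≡ 0
δ-≢ {u = u} {v} u≢v = cong (λ b → if b then 1 else 0) (dec-false (u ≟ v) u≢v)

δ-cong-⇔ : ∀ {n m} {u v : Fin n} {u′ v′ : Fin m} → u ≡ v ⇔ u′ ≡ v′ → δ u v ≡ δ u′ v′
δ-cong-⇔ {u = u} {v} {u′} {v′} eqv = cong (λ b → if b then 1 else 0) (does-⇔ eqv (u ≟ v) (u′ ≟ v′))

δ-injective : ∀ {m n} {f : Fin m → Fin n} → Injective _≡_ _≡_ f → ∀ u v → δ (f u) (f v) ≡ δ u v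
δ-injective {f = f} f-injective u v = δ-cong-⇔ (mk⇔ f-injective (cong f))

Σℤ-δ : ∀ {n} (u : Fin n) → Σℤ (λ v → + δ u v) ≡ + 1
Σℤ-δ {suc n} zero    = ≡.trans (Σℤ-suc {n} (λ v → + δ zero v)) (cong (_+_ (+ 1)) (Σℤ-0 n))
Σℤ-δ {suc n} (suc u) = begin
  Σℤ (λ v → + δ (suc u) v)        ≡⟨ Σℤ-suc {n} (λ v → + δ (suc u) v) ⟩
  + 0 + Σℤ (λ v → + δ u v)        ≡⟨ ℤP.+-identityˡ _ ⟩
  Σℤ (λ v → + δ u v)              ≡⟨ Σℤ-δ u ⟩
  + 1                             ∎
  where open ≡.≡-Reasoning

-- Net degrees

arcNet : ∀ {n} → Edge n → Fin n → ℤ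
arcNet d v = + δ (proj₁ d) v - + δ (proj₂ d) v

outdeg-∷ : ∀ {n} (d : Edge n) D v → outdeg (d ∷ D) v ≡ δ (proj₁ d) v ℕ.+ outdeg D v
outdeg-∷ d D v with does (proj₁ d ≟ v)
... | true  = refl
... | false = refl

indeg-∷ : ∀ {n} (d : Edge n) D v → indeg (d ∷ D) v ≡ δ (proj₂ d) v ℕ.+ indeg D v
indeg-∷ d D v with does (proj₂ d ≟ v)
... | true  = refl
... | false = refl

net-∷ : ∀ {n} (d : Edge n) D v → net (d ∷ D) v ≡ arcNet d v + net D v
net-∷ d D v = begin
  + outdeg (d ∷ D) v - + indeg (d ∷ D) v
    ≡⟨ cong₂ (λ o i → + o - + i) (outdeg-∷ d D v) (indeg-∷ d D v) ⟩
  + (δ (proj₁ d) v ℕ.+ outdeg D v) - + (δ (proj₂ d) v ℕ.+ indeg D v)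
    ≡⟨ cong₂ _-_ (ℤP.pos-+ (δ (proj₁ d) v) _) (ℤP.pos-+ (δ (proj₂ d) v) _) ⟩
  (+ δ (proj₁ d) v + + outdeg D v) - (+ δ (proj₂ d) v + + indeg D v)
    ≡⟨ regroup (+ δ (proj₁ d) v) (+ outdeg D v) (+ δ (proj₂ d) v) (+ indeg D v) ⟩
  arcNet d v + net D v ∎
  where
  open ≡.≡-Reasoning
  regroup : ∀ a b c d → (a + b) - (c + d) ≡ (a - c) + (b - d)
  regroup = solve-∀

net-++ : ∀ {n} (D D′ : List (Edge n)) v → net (D ++ D′) v ≡ net D v + net D′ v
net-++ []      D′ v = ≡.sym (ℤP.+-identityˡ _)
net-++ (d ∷ D) D′ v = begin
  net (d ∷ D ++ D′) v                 ≡⟨ net-∷ d (D ++ D′) v ⟩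
  arcNet d v + net (D ++ D′) v        ≡⟨ cong (_+_ (arcNet d v)) (net-++ D D′ v) ⟩
  arcNet d v + (net D v + net D′ v)   ≡⟨ ℤP.+-assoc (arcNet d v) _ _ ⟨
  (arcNet d v + net D v) + net D′ v   ≡⟨ cong (λ x → x + net D′ v) (net-∷ d D v) ⟨
  net (d ∷ D) v + net D′ v            ∎
  where open ≡.≡-Reasoning

net-↭ : ∀ {n} {D D′ : List (Edge n)} → D ↭ D′ → ∀ v → net D v ≡ net D′ v
net-↭ D↭D′ v = cong₂ (λ o i → + o - + i)
  (PermP.↭-length (PermP.filter-↭ (λ d → proj₁ d ≟ v) D↭D′))
  (PermP.↭-length (PermP.filter-↭ (λ d → proj₂ d ≟ v) D↭D′))

Σℤ-arcNet : ∀ {n} (d : Edge n) → Σℤ (arcNet d) ≡ + 0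
Σℤ-arcNet (u , v) = begin
  Σℤ (arcNet (u , v))                                ≡⟨ Σℤ-- (λ w → + δ u w) (λ w → + δ v w) ⟩
  Σℤ (λ w → + δ u w) - Σℤ (λ w → + δ v w)            ≡⟨ cong₂ _-_ (Σℤ-δ u) (Σℤ-δ v) ⟩
  + 0                                                ∎
  where open ≡.≡-Reasoning

Σℤ-net : ∀ {n} (D : List (Edge n)) → Σℤ (net D) ≡ + 0
Σℤ-net {n} []      = Σℤ-0 n
Σℤ-net     (d ∷ D) = begin
  Σℤ (net (d ∷ D))                   ≡⟨ Σℤ-cong (net-∷ d D) ⟩
  Σℤ (λ v → arcNet d v + net D v)    ≡⟨ Σℤ-+ (arcNet d) (net D) ⟩
  Σℤ (arcNet d) + Σℤ (net D)         ≡⟨ cong₂ _+_ (Σℤ-arcNet d) (Σℤ-net D) ⟩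
  + 0                                ∎
  where open ≡.≡-Reasoning

δ-Joins : ∀ {n} {e d : Edge n} → Joins (proj₁ e) (proj₂ e) d → ∀ v →
  δ (proj₁ d) v ℕ.+ δ (proj₂ d) v ≡ δ (proj₁ e) v ℕ.+ δ (proj₂ e) v
δ-Joins {e = e} (inj₁ refl) v = refl
δ-Joins {e = e} (inj₂ refl) v = ℕP.+-comm (δ (proj₂ e) v) _

deg-orientation : ∀ {n} {G D : List (Edge n)} → IsOrientation G D → ∀ v →
  outdeg D v ℕ.+ indeg D v ≡ deg G v
deg-orientation             []                    v = refl
deg-orientation {G = e ∷ G} {d ∷ D} (d-joins ∷ o) v = begin
  outdeg (d ∷ D) v ℕ.+ indeg (d ∷ D) v
    ≡⟨ cong₂ ℕ._+_ (outdeg-∷ d D v) (indeg-∷ d D v) ⟩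
  (δ (proj₁ d) v ℕ.+ outdeg D v) ℕ.+ (δ (proj₂ d) v ℕ.+ indeg D v)
    ≡⟨ interchange (δ (proj₁ d) v) _ _ _ ⟩
  (δ (proj₁ d) v ℕ.+ δ (proj₂ d) v) ℕ.+ (outdeg D v ℕ.+ indeg D v)
    ≡⟨ cong₂ ℕ._+_ (δ-Joins d-joins v) (deg-orientation o v) ⟩
  (δ (proj₁ e) v ℕ.+ δ (proj₂ e) v) ℕ.+ (outdeg G v ℕ.+ indeg G v)
    ≡⟨ interchange (δ (proj₁ e) v) _ _ _ ⟨
  (δ (proj₁ e) v ℕ.+ outdeg G v) ℕ.+ (δ (proj₂ e) v ℕ.+ indeg G v)
    ≡⟨ cong₂ ℕ._+_ (outdeg-∷ e G v) (indeg-∷ e G v) ⟨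
  deg (e ∷ G) v ∎
  where
  open ≡.≡-Reasoning
  interchange : ∀ a b c d → (a ℕ.+ b) ℕ.+ (c ℕ.+ d) ≡ (a ℕ.+ c) ℕ.+ (b ℕ.+ d)
  interchange = ℕSolver.solve-∀

net≡deg-mod-2 : ∀ {n} {G D : List (Edge n)} → IsOrientation G D → ∀ v → net D v ≡ + deg G v mod 2
net≡deg-mod-2 {G = G} {D} o v = mod-by (Sg.divides (- + indeg D v) (begin
  net D v - + deg G v
    ≡⟨ cong (λ x → net D v - + x) (deg-orientation o v) ⟨
  net D v - + (outdeg D v ℕ.+ indeg D v)
    ≡⟨ cong (λ x → net D v - x) (ℤP.pos-+ (outdeg D v) _) ⟩
  (+ outdeg D v - + indeg D v) - (+ outdeg D v + + indeg D v)
    ≡⟨ twice-in (+ outdeg D v) (+ indeg D v) ⟩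
  - + indeg D v * + 2 ∎))
  where
  open ≡.≡-Reasoning
  twice-in : ∀ o i → (o - i) - (o + i) ≡ - i * + 2
  twice-in = solve-∀

net≡pc-boundary : ∀ {k n} {G D : List (Edge n)} {β : Fin n → ℤ} → ¬ 2 ℕ∣.∣ k →
  IsOrientation G D → ∀ v → + 2 ℤ∣.∣ (β v - + deg G v) →
  net D v ≡ β v mod k → net D v ≡ β v mod (2 ℕ.* k)
net≡pc-boundary {β = β} 2∤k o v β≡deg net≡β = ≡-mod-2* 2∤k net≡β
  (≡-mod-trans (net≡deg-mod-2 o v) (≡-mod-sym (∣ᵤ⇒≡-mod (β v) _ β≡deg)))

-- Strongly Z_k-connected graphs

↭-Pointwise : ∀ {A B : Set} {_∼_ : A → B → Set} {xs ys : List A} {zs : List B} →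
  xs ↭ ys → Pointwise _∼_ ys zs → ∃[ ws ] (Pointwise _∼_ xs ws × ws ↭ zs)
↭-Pointwise {zs = zs} ↭.refl ys∼zs = zs , ys∼zs , ↭.refl
↭-Pointwise (↭.prep x xs↭ys) (y∼z ∷ ys∼zs) =
  let ws , xs∼ws , ws↭zs = ↭-Pointwise xs↭ys ys∼zs in _ ∷ ws , y∼z ∷ xs∼ws , ↭.prep _ ws↭zs
↭-Pointwise (↭.swap x y xs↭ys) (y∼z ∷ y′∼z′ ∷ ys∼zs) =
  let ws , xs∼ws , ws↭zs = ↭-Pointwise xs↭ys ys∼zs in _ ∷ _ ∷ ws , y′∼z′ ∷ y∼z ∷ xs∼ws , ↭.swap _ _ ws↭zs
↭-Pointwise (↭.trans xs↭ys ys↭ys′) ys′∼zs =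
  let ws , ys∼ws , ws↭zs = ↭-Pointwise ys↭ys′ ys′∼zs
      vs , xs∼vs , vs↭ws = ↭-Pointwise xs↭ys ys∼ws
  in vs , xs∼vs , ↭.↭-trans vs↭ws ws↭zs

SZ-realises : ∀ {k n} .{{_ : NonZero k}} {R : Graph n} → SZ k R →
  (t : Fin n → ℤ) → Σℤ t ≡ + 0 mod k →
  ∃[ D ] (IsOrientation R D × ∀ v → net D v ≡ t v mod k)
SZ-realises {k} szR t Σt≡0 =
  let D , o , net≡γ = szR γ γ-boundary
  in D , o , λ v → ≡-mod-trans (∣ᵤ⇒≡-mod (net D v) _ (net≡γ v)) (γ≡t v)
  where
  γ : _ → Fin k
  γ v = proj₁ (residue k (t v))
  γ≡t : ∀ v → + toℕ (γ v) ≡ t v mod k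
  γ≡t v = proj₂ (residue k (t v))
  γ-boundary : IsZkBoundary k γ
  γ-boundary = ≡0-mod⇒∣ᵤ (≡-mod-trans (Σℤ-cong-mod γ≡t) Σt≡0)

SZ-extend : ∀ {k n} .{{_ : NonZero k}} {G F R A : List (Edge n)} → SZ k R →
  G ↭ F ++ R → IsOrientation F A → (γ : Fin n → ℤ) → Σℤ γ ≡ + 0 mod k →
  ∃[ D ] ∃[ DR ] (IsOrientation G D × D ↭ A ++ DR × ∀ v → net D v ≡ γ v mod k)
SZ-extend {k} {A = A} szR G↭F+R oA γ Σγ≡0 =
  let DR , oR , netDR≡γ-netA = SZ-realises szR (λ v → γ v - net A v) Σ[γ-netA]≡0
      D , oG , D↭A+DR = ↭-Pointwise G↭F+R (Pointwise.++⁺ oA oR)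
  in D , DR , oG , D↭A+DR , λ v → begin
    net D v                      ≡⟨ ≡.trans (net-↭ D↭A+DR v) (net-++ A DR v) ⟩
    net A v + net DR v           ≈⟨ +-congˡ-mod (net A v) (netDR≡γ-netA v) ⟩
    net A v + (γ v - net A v)    ≡⟨ cancel (net A v) (γ v) ⟩
    γ v                          ∎
  where
  open mod-Reasoning k
  cancel : ∀ a b → a + (b - a) ≡ b
  cancel = solve-∀
  Σ[γ-netA]≡0 : Σℤ (λ v → γ v - net A v) ≡ + 0 mod k
  Σ[γ-netA]≡0 = begin
    Σℤ (λ v → γ v - net A v)   ≡⟨ Σℤ-- γ (net A) ⟩
    Σℤ γ - Σℤ (net A)          ≡⟨ cong (_-_ (Σℤ γ)) (Σℤ-net A) ⟩
    Σℤ γ - + 0                 ≡⟨ ℤP.+-identityʳ (Σℤ γ) ⟩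
    Σℤ γ                       ≈⟨ Σγ≡0 ⟩
    + 0                        ∎

-- For even k a realised boundary is ≡ deg (mod 2) at u, so the boundaries 0 and arcNet (u , v),
-- which is 1 at u, cannot both be realised.
SZ⇒odd : ∀ {k n} {R : Graph n} {u v : Fin n} → 1 ≤ k → u ≢ v → SZ k R → ¬ 2 ℕ∣.∣ k
SZ⇒odd {k} {n} {R} {u} {v} 1≤k u≢v szR 2∣k = 2∤1 (divides-difference (begin
  + 1                ≡⟨ cong₂ (λ x y → + x - + y) (δ-refl u) (δ-≢ (u≢v ∘ ≡.sym)) ⟨
  arcNet (u , v) u   ≈⟨ realised≡deg (arcNet (u , v)) (≡⇒≡-mod (Σℤ-arcNet (u , v))) ⟩
  + deg R u          ≈⟨ realised≡deg (λ _ → + 0) (≡⇒≡-mod (Σℤ-0 n)) ⟨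
  + 0                ∎))
  where
  open mod-Reasoning 2
  instance
    k≢0 : NonZero k
    k≢0 = ℕ.>-nonZero 1≤k
  realised≡deg : ∀ t → Σℤ t ≡ + 0 mod k → t u ≡ + deg R u mod 2
  realised≡deg t Σt≡0 =
    let D , o , net≡t = SZ-realises szR t Σt≡0
    in ≡-mod-trans (≡-mod-∣ 2∣k (≡-mod-sym (net≡t u))) (net≡deg-mod-2 o u)
  2∤1 : ¬ + 2 Sg.∣ + 1
  2∤1 2∣1 with ℕ∣.∣1⇒≡1 (Sg.∣⇒∣ᵤ 2∣1)
  ... | ()

-- Cuts crossed along walks

Joins-as-arc : ∀ {n} {p q : Fin n} {e : Edge n} → Joins p q e → Joins (proj₁ e) (proj₂ e) (p , q)
Joins-as-arc (inj₁ refl) = inj₁ refl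
Joins-as-arc (inj₂ refl) = inj₂ refl

position : ∀ {m n} {f : Fin m → Fin n} → Bijective _≡_ _≡_ f → ∀ y → ∃[ i ] f i ≡ y
position (_ , f-surjective) y = let i , fi≡y = f-surjective y in i , fi≡y refl

Crossing : ∀ {n} → Bool → (Fin n → Bool) → Edge n → Set
Crossing s S d = S (proj₁ d) ≡ s × S (proj₂ d) ≡ not s

Leaves Enters : ∀ {n} → (Fin n → Bool) → Edge n → Set
Leaves = Crossing true
Enters = Crossing false

Crossed : ∀ {n} → (Fin n → Bool) → List (Edge n) → Set
Crossed S D = Any (Leaves S) D × Any (Enters S) D

crossed : ∀ {n} {S : Fin n → Bool} {D} s → Any (Crossing s S) D → Any (Crossing (not s) S) D → Crossed S D
crossed true  c c′ = c , c′
crossed false c c′ = c′ , c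

Exit : ∀ {m} → (Fin (suc m) → Set) → Fin m → Set
Exit P i = P (inject₁ i) × ¬ P (suc i)

exit-before : ∀ {m} {P : Fin (suc m) → Set} → Decidable P → ∀ {j} → P zero → ¬ P j → ∃ (Exit P)
exit-before {zero}  P? {zero}  p₀ ¬pⱼ = ⊥-elim (¬pⱼ p₀)
exit-before {suc m} P? {zero}  p₀ ¬pⱼ = ⊥-elim (¬pⱼ p₀)
exit-before {suc m} P? {suc j} p₀ ¬pⱼ with P? (suc zero)
... | no ¬p₁ = zero , p₀ , ¬p₁
... | yes p₁ = let i , exit = exit-before (P? ∘ suc) p₁ ¬pⱼ in suc i , exit

exit-after : ∀ {m} {P : Fin (suc m) → Set} → Decidable P → ∀ {j} → P j → ¬ P (fromℕ m) → ∃ (Exit P)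
exit-after {zero}  P? {zero}  pⱼ ¬pₘ = ⊥-elim (¬pₘ pⱼ)
exit-after {suc m} P? {zero}  p₀ ¬pₘ with P? (suc zero)
... | no ¬p₁ = zero , p₀ , ¬p₁
... | yes p₁ = let i , exit = exit-after (P? ∘ suc) {zero} p₁ ¬pₘ in suc i , exit
exit-after {suc m} P? {suc j} pⱼ ¬pₘ = let i , exit = exit-after (P? ∘ suc) {j} pⱼ ¬pₘ in suc i , exit

cnext-inject₁ : ∀ {m} (i : Fin m) → cnext (inject₁ i) ≡ suc i
cnext-inject₁ {suc m} zero    = refl
cnext-inject₁ {suc m} (suc i) rewrite cnext-inject₁ i = refl

cnext-fromℕ : ∀ m → cnext (fromℕ m) ≡ zero
cnext-fromℕ zero    = refl
cnext-fromℕ (suc m) rewrite cnext-fromℕ m = refl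

CyclicExit : ∀ {m} → (Fin (suc m) → Set) → Fin (suc m) → Set
CyclicExit P l = P l × ¬ P (cnext l)

exit⇒cyclic-exit : ∀ {m} {P : Fin (suc m) → Set} → ∃ (Exit P) → ∃ (CyclicExit P)
exit⇒cyclic-exit {P = P} (l , pₗ , ¬pₗ₊₁) =
  inject₁ l , pₗ , ≡.subst (¬_ ∘ P) (≡.sym (cnext-inject₁ l)) ¬pₗ₊₁

cyclic-exit : ∀ {m} {P : Fin (suc m) → Set} → Decidable P → ∀ {i j} → P i → ¬ P j → ∃ (CyclicExit P)
cyclic-exit {m} {P} P? pᵢ ¬pⱼ with P? (fromℕ m) | P? zero
... | no ¬pₘ | _      = exit⇒cyclic-exit (exit-after P? pᵢ ¬pₘ)
... | yes pₘ | no ¬p₀ = fromℕ m , pₘ , ≡.subst (¬_ ∘ P) (≡.sym (cnext-fromℕ m)) ¬p₀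
... | yes pₘ | yes p₀ = exit⇒cyclic-exit (exit-before P? p₀ ¬pⱼ)

≡not⇒≢ : ∀ {x s} → x ≡ not s → x ≢ s
≡not⇒≢ {s = true}  refl ()
≡not⇒≢ {s = false} refl ()

module _ {m} (f : Fin (suc m) → Bool) (s : Bool) where

  Flip : Fin m → Set
  Flip i = f (inject₁ i) ≡ s × f (suc i) ≡ not s

  private
    flip : ∃ (Exit (λ i → f i ≡ s)) → ∃ Flip
    flip (i , fᵢ≡s , fᵢ₊₁≢s) = i , fᵢ≡s , ¬-not fᵢ₊₁≢s

  flip-before : ∀ {j} → f zero ≡ s → f j ≡ not s → ∃ Flip
  flip-before f₀≡s fⱼ≡¬s = flip (exit-before (λ i → f i Bool.≟ s) f₀≡s (≡not⇒≢ fⱼ≡¬s))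

  flip-after : ∀ {j} → f j ≡ s → f (fromℕ m) ≡ not s → ∃ Flip
  flip-after fⱼ≡s fₘ≡¬s = flip (exit-after (λ i → f i Bool.≟ s) fⱼ≡s (≡not⇒≢ fₘ≡¬s))

  cyclic-flip : ∀ {i j} → f i ≡ s → f j ≡ not s → ∃[ l ] (f l ≡ s × f (cnext l) ≡ not s)
  cyclic-flip fᵢ≡s fⱼ≡¬s =
    let l , fₗ≡s , fₗ₊₁≢s = cyclic-exit (λ i → f i Bool.≟ s) fᵢ≡s (≡not⇒≢ fⱼ≡¬s)
    in l , fₗ≡s , ¬-not fₗ₊₁≢s

-- Hamiltonian cycles

cycleArc : ∀ {n} (C : HamCycle n) → Fin (suc (suc (HamCycle.len C))) → Edge n
cycleArc C i = vert i , vert (cnext i)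
  where open HamCycle C

cycleArcs : ∀ {n} → HamCycle n → List (Edge n)
cycleArcs C = List.tabulate (cycleArc C)

cycleArcs-orientation : ∀ {n} (C : HamCycle n) → IsOrientation (cycleEdges C) (cycleArcs C)
cycleArcs-orientation C = Pointwise.tabulate⁺ (Joins-as-arc ∘ HamCycle.joins C)

cycleArcs-stronglyConnected : ∀ {n} (C : HamCycle n) → IsStronglyConnected (cycleArcs C)
cycleArcs-stronglyConnected C S (u , Su) (v , Sv) =
  crossing true (position vbij u) (position vbij v) Su Sv ,
  crossing false (position vbij v) (position vbij u) Sv Su
  where
  open HamCycle C
  crossing : ∀ s {x y} → ∃[ i ] vert i ≡ x → ∃[ j ] vert j ≡ y → S x ≡ s → S y ≡ not s →
    Any (Crossing s S) (cycleArcs C)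
  crossing s (i , refl) (j , refl) Sx≡s Sy≡¬s =
    let l , crossₗ = cyclic-flip (S ∘ vert) s Sx≡s Sy≡¬s in AnyP.tabulate⁺ {f = cycleArc C} l crossₗ

hamCycle-distinct : ∀ {n} (C : HamCycle n) → HamCycle.vert C zero ≢ HamCycle.vert C (suc zero)
hamCycle-distinct C v₀≡v₁ with proj₁ (HamCycle.vbij C) v₀≡v₁
... | ()

⊆-stronglyConnected : ∀ {n} {A X D : List (Edge n)} → IsStronglyConnected A → D ↭ A ++ X →
  IsStronglyConnected D
⊆-stronglyConnected strongA D↭A+X S inside outside =
  let leaves , enters = strongA S inside outside
  in PermP.Any-resp-↭ (↭.↭-sym D↭A+X) (AnyP.++⁺ˡ leaves) ,
     PermP.Any-resp-↭ (↭.↭-sym D↭A+X) (AnyP.++⁺ˡ enters)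

hamCycle-SC : ∀ {k n} {G : Graph n} (C : HamCycle n) (R : Graph n) → ¬ 2 ℕ∣.∣ k →
  G ↭ cycleEdges C ++ R → SZ k R → SC k G
hamCycle-SC {k} C R 2∤k G↭C+R szR β (_ , β≡deg , 2k∣Σβ) =
  let D , _ , oG , D↭C+DR , net≡β = SZ-extend szR G↭C+R (cycleArcs-orientation C) β Σβ≡0
  in D , oG , ⊆-stronglyConnected (cycleArcs-stronglyConnected C) D↭C+DR ,
     λ v → ≡-mod⇒∣ᵤ (net≡pc-boundary {β = β} 2∤k oG v (β≡deg v) (net≡β v))
  where
  instance
    k≢0 : NonZero k
    k≢0 = odd⇒nonZero 2∤k
  Σβ≡0 : Σℤ β ≡ + 0 mod k
  Σβ≡0 = ≡-mod-∣ (ℕ∣.n∣m*n 2) (∣ᵤ⇒≡0-mod (Σℤ β) 2k∣Σβ)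

-- Contraction

mapEdge-Joins : ∀ {m n} (f : Fin m → Fin n) {u v : Fin m} {d : Edge m} →
  Joins u v d → Joins (f u) (f v) (mapEdge f d)
mapEdge-Joins f (inj₁ refl) = inj₁ refl
mapEdge-Joins f (inj₂ refl) = inj₂ refl

map-orientation : ∀ {m n} (f : Fin m → Fin n) {G D : List (Edge m)} → IsOrientation G D →
  IsOrientation (List.map (mapEdge f) G) (List.map (mapEdge f) D)
map-orientation f o = Pointwise.map⁺ (mapEdge f) (mapEdge f) (Pointwise.map (mapEdge-Joins f) o)

net-map : ∀ {m n} (f : Fin m → Fin n) {w : Fin n} {a : Fin m} → (∀ u → δ (f u) w ≡ δ u a) →
  ∀ X → net (List.map (mapEdge f) X) w ≡ net X a
net-map f δ-f []      = refl
net-map f {w} {a} δ-f (x ∷ X) = begin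
  net (mapEdge f x ∷ List.map (mapEdge f) X) w            ≡⟨ net-∷ (mapEdge f x) _ w ⟩
  arcNet (mapEdge f x) w + net (List.map (mapEdge f) X) w ≡⟨ cong₂ _+_ arcNet-f (net-map f δ-f X) ⟩
  arcNet x a + net X a                                    ≡⟨ net-∷ x X a ⟨
  net (x ∷ X) a                                           ∎
  where
  open ≡.≡-Reasoning
  arcNet-f : arcNet (mapEdge f x) w ≡ arcNet x a
  arcNet-f = cong₂ (λ i o → + i - + o) (δ-f (proj₁ x)) (δ-f (proj₂ x))

net-map-∉ : ∀ {m n} (f : Fin m → Fin n) {v : Fin n} → (∀ u → f u ≢ v) →
  ∀ X → net (List.map (mapEdge f) X) v ≡ + 0
net-map-∉ f f≢v []      = refl
net-map-∉ f {v} f≢v (x ∷ X) = begin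
  net (mapEdge f x ∷ List.map (mapEdge f) X) v
    ≡⟨ net-∷ (mapEdge f x) _ v ⟩
  arcNet (mapEdge f x) v + net (List.map (mapEdge f) X) v
    ≡⟨ cong₂ _+_ arcNet-f (net-map-∉ f f≢v X) ⟩
  + 0 ∎
  where
  open ≡.≡-Reasoning
  arcNet-f : arcNet (mapEdge f x) v ≡ + 0
  arcNet-f = cong₂ (λ i o → + i - + o) (δ-≢ (f≢v (proj₁ x))) (δ-≢ (f≢v (proj₂ x)))

module _ {n r} (π : Fin n → Fin (suc r)) where

  contractEdges-loop : ∀ e X → π (proj₁ e) ≡ π (proj₂ e) → contractEdges π (e ∷ X) ≡ contractEdges π X
  contractEdges-loop e X loop =
    cong (List.map (mapEdge π)) (ListP.filter-reject (λ e → ¬? (π (proj₁ e) ≟ π (proj₂ e))) (λ ¬loop → ¬loop loop))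

  contractEdges-nonloop : ∀ e X → π (proj₁ e) ≢ π (proj₂ e) →
    contractEdges π (e ∷ X) ≡ mapEdge π e ∷ contractEdges π X
  contractEdges-nonloop e X ¬loop =
    cong (List.map (mapEdge π)) (ListP.filter-accept (λ e → ¬? (π (proj₁ e) ≟ π (proj₂ e))) ¬loop)

  net-contractEdges : ∀ X w → net (contractEdges π X) w ≡ net (List.map (mapEdge π) X) w
  net-contractEdges []      w = refl
  net-contractEdges (x ∷ X) w = by-cases (π (proj₁ x) ≟ π (proj₂ x))
    where
    open ≡.≡-Reasoning
    πX = List.map (mapEdge π) X
    by-cases : Dec (π (proj₁ x) ≡ π (proj₂ x)) →
      net (contractEdges π (x ∷ X)) w ≡ net (List.map (mapEdge π) (x ∷ X)) w
    by-cases (yes loop) = begin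
      net (contractEdges π (x ∷ X)) w       ≡⟨ cong (λ Y → net Y w) (contractEdges-loop x X loop) ⟩
      net (contractEdges π X) w             ≡⟨ net-contractEdges X w ⟩
      net πX w                              ≡⟨ ℤP.+-identityˡ _ ⟨
      + 0 + net πX w                        ≡⟨ cong (λ z → z + net πX w) loop-net ⟨
      arcNet (mapEdge π x) w + net πX w     ≡⟨ net-∷ (mapEdge π x) πX w ⟨
      net (List.map (mapEdge π) (x ∷ X)) w  ∎
      where
      loop-net : arcNet (mapEdge π x) w ≡ + 0
      loop-net = ≡.trans (cong (λ z → + δ z w - + δ (π (proj₂ x)) w) loop)
                         (ℤP.+-inverseʳ (+ δ (π (proj₂ x)) w))
    by-cases (no ¬loop) = begin
      net (contractEdges π (x ∷ X)) w
        ≡⟨ cong (λ Y → net Y w) (contractEdges-nonloop x X ¬loop) ⟩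
      net (mapEdge π x ∷ contractEdges π X) w
        ≡⟨ net-∷ (mapEdge π x) _ w ⟩
      arcNet (mapEdge π x) w + net (contractEdges π X) w
        ≡⟨ cong (_+_ (arcNet (mapEdge π x) w)) (net-contractEdges X w) ⟩
      arcNet (mapEdge π x) w + net πX w
        ≡⟨ net-∷ (mapEdge π x) πX w ⟨
      net (List.map (mapEdge π) (x ∷ X)) w ∎

  contractEdges⁻ : ∀ {P : Edge (suc r) → Set} {X} → Any P (contractEdges π X) → Any (P ∘ mapEdge π) X
  contractEdges⁻ = AnyP.filter⁻ _ ∘ AnyP.map⁻

  lift-orientation : ∀ R D′ → IsOrientation (contractEdges π R) D′ →
    ∃[ D ] (IsOrientation R D × contractEdges π D ≡ D′)
  lift-orientation []      []  [] = [] , [] , refl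
  lift-orientation (e ∷ R) D′  o  = by-cases (π (proj₁ e) ≟ π (proj₂ e))
    where
    Lift : List (Edge (suc r)) → Set
    Lift D′ = ∃[ D ] (IsOrientation (e ∷ R) D × contractEdges π D ≡ D′)
    lift-arc : π (proj₁ e) ≢ π (proj₂ e) → ∀ {D′} → IsOrientation (mapEdge π e ∷ contractEdges π R) D′ → Lift D′
    lift-arc ¬loop (inj₁ refl ∷ o′) =
      let D , oR , D↦D′ = lift-orientation R _ o′
      in e ∷ D , inj₁ refl ∷ oR , ≡.trans (contractEdges-nonloop e D ¬loop) (cong (_ ∷_) D↦D′)
    lift-arc ¬loop (inj₂ refl ∷ o′) =
      let D , oR , D↦D′ = lift-orientation R _ o′
      in (proj₂ e , proj₁ e) ∷ D , inj₂ refl ∷ oR ,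
         ≡.trans (contractEdges-nonloop (proj₂ e , proj₁ e) D (¬loop ∘ ≡.sym)) (cong (_ ∷_) D↦D′)
    by-cases : Dec (π (proj₁ e) ≡ π (proj₂ e)) → Lift D′
    by-cases (yes loop) =
      let D , oR , D↦D′ = lift-orientation R D′ (≡.subst (λ Y → IsOrientation Y D′) (contractEdges-loop e R loop) o)
      in e ∷ D , inj₁ refl ∷ oR , ≡.trans (contractEdges-loop e D loop) D↦D′
    by-cases (no ¬loop) = lift-arc ¬loop (≡.subst (λ Y → IsOrientation Y D′) (contractEdges-nonloop e R ¬loop) o)

UniformOn : ∀ {h n} → (Fin h → Fin n) → (Fin n → Bool) → Set
UniformOn ι S = ∀ a b → S (ι a) ≡ S (ι b)

UniformCutsCrossed : ∀ {h n} → (Fin h → Fin n) → List (Edge n) → Set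
UniformCutsCrossed {n = n} ι D =
  ∀ (S : Fin n → Bool) → UniformOn ι S → (∃[ v ] S v ≡ true) → (∃[ v ] S v ≡ false) → Crossed S D

uniformCutsCrossed-++ : ∀ {h n} {ι : Fin h → Fin n} (X : List (Edge n)) {D} →
  UniformCutsCrossed ι D → UniformCutsCrossed ι (X ++ D)
uniformCutsCrossed-++ X cuts S uniform inside outside =
  let leaves , enters = cuts S uniform inside outside in AnyP.++⁺ʳ X leaves , AnyP.++⁺ʳ X enters

Crossing-map : ∀ {m n} {f : Fin m → Fin n} {S : Fin m → Bool} {S′ : Fin n → Bool} {s d} →
  (∀ v → S′ (f v) ≡ S v) → Crossing s S′ (mapEdge f d) → Crossing s S d
Crossing-map S′∘f≗S (p , q) = ≡.trans (≡.sym (S′∘f≗S _)) p , ≡.trans (≡.sym (S′∘f≗S _)) q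

module Contraction {h n r} {ι : Fin h → Fin n} {π : Fin n → Fin (suc r)}
                   (ι-injective : Injective _≡_ _≡_ ι) (contraction : IsContractionMap ι π) where

  fibre-of-zero : ∀ v → π v ≡ zero → ∃[ a ] ι a ≡ v
  fibre-of-zero = proj₁ contraction
  π∘ι≡zero : ∀ a → π (ι a) ≡ zero
  π∘ι≡zero = proj₁ (proj₂ contraction)
  π-injective-outside : ∀ u v → π u ≡ π v → π u ≢ zero → u ≡ v
  π-injective-outside = proj₁ (proj₂ (proj₂ contraction))
  π-surjective : ∀ j → ∃[ v ] π v ≡ j
  π-surjective = proj₂ (proj₂ (proj₂ contraction))

  net-outside : ∀ X {v} → π v ≢ zero → net X v ≡ net (contractEdges π X) (π v)
  net-outside X {v} πv≢0 = ≡.sym (≡.trans (net-contractEdges π X (π v)) (net-map π δ-π X))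
    where
    δ-π : ∀ u → δ (π u) (π v) ≡ δ u v
    δ-π u = δ-cong-⇔ (mk⇔ (λ πu≡πv → π-injective-outside u v πu≡πv (πv≢0 ∘ ≡.trans (≡.sym πu≡πv))) (cong π))

  Σℤ-δ-image : ∀ u → Σℤ (λ a → + δ u (ι a)) ≡ + δ (π u) zero
  Σℤ-δ-image u = by-cases (π u ≟ zero)
    where
    open ≡.≡-Reasoning
    by-cases : Dec (π u ≡ zero) → Σℤ (λ a → + δ u (ι a)) ≡ + δ (π u) zero
    by-cases (yes πu≡0) = let a₀ , ιa₀≡u = fibre-of-zero u πu≡0 in begin
      Σℤ (λ a → + δ u (ι a))     ≡⟨ Σℤ-cong (λ a → cong (λ x → + δ x (ι a)) ιa₀≡u) ⟨
      Σℤ (λ a → + δ (ι a₀) (ι a))≡⟨ Σℤ-cong (λ a → cong +_ (δ-injective ι-injective a₀ a)) ⟩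
      Σℤ (λ a → + δ a₀ a)        ≡⟨ Σℤ-δ a₀ ⟩
      + 1                        ≡⟨ cong +_ (δ-refl {suc r} zero) ⟨
      + δ {suc r} zero zero      ≡⟨ cong (λ j → + δ j zero) πu≡0 ⟨
      + δ (π u) zero             ∎
    by-cases (no πu≢0) = begin
      Σℤ (λ a → + δ u (ι a))
        ≡⟨ Σℤ-cong (λ a → cong +_ (δ-≢ (λ u≡ιa → πu≢0 (≡.trans (cong π u≡ιa) (π∘ι≡zero a))))) ⟩
      Σℤ {h} (λ _ → + 0)
        ≡⟨ Σℤ-0 h ⟩
      + 0
        ≡⟨ cong +_ (δ-≢ πu≢0) ⟨
      + δ (π u) zero ∎

  Σℤ-net-inside : ∀ X → Σℤ (λ a → net X (ι a)) ≡ net (contractEdges π X) zero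
  Σℤ-net-inside X = ≡.trans (Σℤ-net-map X) (≡.sym (net-contractEdges π X zero))
    where
    Σℤ-net-map : ∀ X → Σℤ (λ a → net X (ι a)) ≡ net (List.map (mapEdge π) X) zero
    Σℤ-net-map []      = Σℤ-0 h
    Σℤ-net-map (x ∷ X) = begin
      Σℤ (λ a → net (x ∷ X) (ι a))
        ≡⟨ Σℤ-cong (λ a → net-∷ x X (ι a)) ⟩
      Σℤ (λ a → arcNet x (ι a) + net X (ι a))
        ≡⟨ Σℤ-+ (λ a → arcNet x (ι a)) _ ⟩
      Σℤ (λ a → arcNet x (ι a)) + Σℤ (λ a → net X (ι a))
        ≡⟨ cong₂ _+_ Σℤ-arcNet-inside (Σℤ-net-map X) ⟩
      arcNet (mapEdge π x) zero + net (List.map (mapEdge π) X) zero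
        ≡⟨ net-∷ (mapEdge π x) _ zero ⟨
      net (List.map (mapEdge π) (x ∷ X)) zero ∎
      where
      open ≡.≡-Reasoning
      Σℤ-arcNet-inside : Σℤ (λ a → arcNet x (ι a)) ≡ arcNet (mapEdge π x) zero
      Σℤ-arcNet-inside = ≡.trans (Σℤ-- (λ a → + δ (proj₁ x) (ι a)) (λ a → + δ (proj₂ x) (ι a)))
                                 (cong₂ _-_ (Σℤ-δ-image (proj₁ x)) (Σℤ-δ-image (proj₂ x)))

  -- A cut that is uniform on the image of ι factors through π.
  uniform-cuts-crossed : ∀ {D} → IsStronglyConnected (contractEdges π D) → UniformCutsCrossed ι D
  uniform-cuts-crossed {D} strong S uniform (u , Su) (v , Sv) =
    let leaves , enters = strong S′ (π u , ≡.trans (S′∘π≗S u) Su) (π v , ≡.trans (S′∘π≗S v) Sv)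
    in Any.map (Crossing-map {f = π} {S′ = S′} S′∘π≗S) (contractEdges⁻ π leaves) ,
       Any.map (Crossing-map {f = π} {S′ = S′} S′∘π≗S) (contractEdges⁻ π enters)
    where
    S′ : Fin (suc r) → Bool
    S′ j = S (proj₁ (π-surjective j))
    S′∘π≗S : ∀ v → S′ (π v) ≡ S v
    S′∘π≗S v with π-surjective (π v) | π v ≟ zero
    ... | u , πu≡πv | yes πv≡0 =
      let a , ιa≡u = fibre-of-zero u (≡.trans πu≡πv πv≡0)
          b , ιb≡v = fibre-of-zero v πv≡0
      in ≡.trans (cong S (≡.sym ιa≡u)) (≡.trans (uniform a b) (cong S ιb≡v))
    ... | u , πu≡πv | no πv≢0 = cong S (π-injective-outside u v πu≡πv (πv≢0 ∘ ≡.trans (≡.sym πu≡πv)))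

-- Reachability

-- y is reachable from x along arcs of D, stated with cuts so that it is decidable by
-- enumerating subsets.
Reaches : ∀ {n} → List (Edge n) → Fin n → Fin n → Set
Reaches {n} D x y = ∀ (S : Fin n → Bool) → S x ≡ false → S y ≡ true → Any (Enters S) D

from-does : ∀ {A : Set} (a? : Dec A) → does a? ≡ true → A
from-does (yes a) _ = a

module _ {n} {D : List (Edge n)} where

  reaches-refl : ∀ x → Reaches D x x
  reaches-refl x S Sx≡false Sx≡true with ≡.trans (≡.sym Sx≡false) Sx≡true
  ... | ()

  reaches-trans : ∀ {x y z} → Reaches D x y → Reaches D y z → Reaches D x z
  reaches-trans {y = y} x⇝y y⇝z S Sx Sz with S y in Sy
  ... | true  = x⇝y S Sx Sy
  ... | false = y⇝z S Sy Sz

  reaches-arc : ∀ {x y} → (x , y) ∈ D → Reaches D x y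
  reaches-arc xy∈D S Sx Sy = Any.map (λ { refl → Sx , Sy }) xy∈D

  reaches? : ∀ x y → Dec (Reaches D x y)
  reaches? x y = Dec.map′ unblocked⇒reaches reaches⇒unblocked (¬? (anySubset? blocks?))
    where
    enters? : ∀ S → Decidable (Enters {n} S)
    enters? S d = (S (proj₁ d) Bool.≟ false) ×-dec (S (proj₂ d) Bool.≟ true)
    Blocks : Subset n → Set
    Blocks S = Vec.lookup S x ≡ false × Vec.lookup S y ≡ true × ¬ Any (Enters (Vec.lookup S)) D
    blocks? : Decidable Blocks
    blocks? S = (Vec.lookup S x Bool.≟ false) ×-dec (Vec.lookup S y Bool.≟ true) ×-dec
                ¬? (Any.any? (enters? (Vec.lookup S)) D)
    unblocked⇒reaches : ¬ ∃ Blocks → Reaches D x y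
    unblocked⇒reaches unblocked S Sx Sy with Any.any? (enters? S) D
    ... | yes enters = enters
    ... | no ¬enters = ⊥-elim (unblocked (Vec.tabulate S ,
      ≡.trans (VecP.lookup∘tabulate S x) Sx , ≡.trans (VecP.lookup∘tabulate S y) Sy ,
      ¬enters ∘ Any.map (Crossing-map {f = λ v → v} {S′ = Vec.lookup (Vec.tabulate S)} (VecP.lookup∘tabulate S))))
    reaches⇒unblocked : Reaches D x y → ¬ ∃ Blocks
    reaches⇒unblocked x⇝y (S , Sx , Sy , ¬enters) = ¬enters (x⇝y (Vec.lookup S) Sx Sy)

reaches-++ : ∀ {n} (X : List (Edge n)) {D x y} → Reaches D x y → Reaches (X ++ D) x y
reaches-++ X x⇝y S Sx Sy = AnyP.++⁺ʳ X (x⇝y S Sx Sy)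

orientation-arc : ∀ {n} {R D : List (Edge n)} {p q} → IsOrientation R D → Any (Joins p q) R →
  (p , q) ∈ D ⊎ (q , p) ∈ D
orientation-arc (d-joins ∷ o) (here e-joins) = Sum.map here here (arc d-joins e-joins)
  where
  arc : ∀ {e d : Edge _} {p q} → Joins (proj₁ e) (proj₂ e) d → Joins p q e → (p , q) ≡ d ⊎ (q , p) ≡ d
  arc (inj₁ refl) (inj₁ refl) = inj₁ refl
  arc (inj₁ refl) (inj₂ refl) = inj₂ refl
  arc (inj₂ refl) (inj₁ refl) = inj₂ refl
  arc (inj₂ refl) (inj₂ refl) = inj₁ refl
orientation-arc (_ ∷ o) (there e∈R) = Sum.map there there (orientation-arc o e∈R)

ReachablePair : ∀ {h n} → (Fin h → Fin n) → List (Edge n) → Set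
ReachablePair ι D = ∃[ a ] ∃[ b ] (a ≢ b × Reaches D (ι b) (ι a))

module _ {h n} {ι : Fin h → Fin n} {D : List (Edge n)} (cuts : UniformCutsCrossed ι D) (a₀ : Fin h) where

  private
    image-cut-crossed : (S : Fin n → Bool) → (∀ a → S (ι a) ≡ true) → ∀ {p} → S p ≡ false → Crossed S D
    image-cut-crossed S S-image Sp =
      cuts S (λ a b → ≡.trans (S-image a) (≡.sym (S-image b))) (ι a₀ , S-image a₀) (_ , Sp)

  reached-from-image : ∀ p → ∃[ a ] Reaches D (ι a) p
  reached-from-image p = Dec.decidable-stable (reached? p) λ unreached →
    let (x , y) , xy∈D , Sx , Sy = find (proj₁ (image-cut-crossed S S-image (dec-false (reached? p) unreached)))
        a , ιa⇝x = from-does (reached? x) Sx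
    in not-¬ (dec-true (reached? y) (a , reaches-trans ιa⇝x (reaches-arc xy∈D))) Sy
    where
    reached? : ∀ v → Dec (∃[ a ] Reaches D (ι a) v)
    reached? v = FinP.any? (λ a → reaches? (ι a) v)
    S : Fin n → Bool
    S v = does (reached? v)
    S-image : ∀ a → S (ι a) ≡ true
    S-image a = dec-true (reached? (ι a)) (a , reaches-refl (ι a))

  reaches-image : ∀ p → ∃[ a ] Reaches D p (ι a)
  reaches-image p = Dec.decidable-stable (reaching? p) λ unreaching →
    let (x , y) , xy∈D , Sx , Sy = find (proj₂ (image-cut-crossed S S-image (dec-false (reaching? p) unreaching)))
        a , y⇝ιa = from-does (reaching? y) Sy
    in not-¬ (dec-true (reaching? x) (a , reaches-trans (reaches-arc xy∈D) y⇝ιa)) Sx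
    where
    reaching? : ∀ v → Dec (∃[ a ] Reaches D v (ι a))
    reaching? v = FinP.any? (λ a → reaches? v (ι a))
    S : Fin n → Bool
    S v = does (reaching? v)
    S-image : ∀ a → S (ι a) ≡ true
    S-image a = dec-true (reaching? (ι a)) (a , reaches-refl (ι a))

  -- Were there no such pair, the strong component of ι a₀ would contain no other image vertex.
  -- The route to ι b₀ leaves the component along an edge; whichever way it is oriented, the
  -- image vertex reached from (or reaching) its far end puts that end into the component.
  reachable-pair : ∀ {R b₀} → IsOrientation R D → a₀ ≢ b₀ → PathIn R (ι a₀) (ι b₀) → ReachablePair ι D
  reachable-pair {R} {b₀} oR a₀≢b₀ path = Dec.decidable-stable pair? no-pair-absurd
    where
    open PathIn path
    pair? : Dec (ReachablePair ι D)
    pair? = FinP.any? λ a → FinP.any? λ b → ¬? (a ≟ b) ×-dec reaches? (ι b) (ι a)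
    StronglyLinked : Fin n → Set
    StronglyLinked t = Reaches D (ι a₀) t × Reaches D t (ι a₀)
    no-pair-absurd : ¬ ¬ ReachablePair ι D
    no-pair-absurd no-pair = exit-absurd (exit-before linked? first-linked last-unlinked)
      where
      linked? : Decidable (StronglyLinked ∘ vert)
      linked? i = reaches? (ι a₀) (vert i) ×-dec reaches? (vert i) (ι a₀)
      first-linked : StronglyLinked (vert zero)
      first-linked = ≡.subst StronglyLinked (≡.sym start) (reaches-refl (ι a₀) , reaches-refl (ι a₀))
      last-unlinked : ¬ StronglyLinked (vert (fromℕ len))
      last-unlinked (ιa₀⇝last , _) = no-pair (b₀ , a₀ , a₀≢b₀ ∘ ≡.sym , ≡.subst (Reaches D (ι a₀)) end ιa₀⇝last)
      exit-absurd : ∃ (Exit (StronglyLinked ∘ vert)) → ⊥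
      exit-absurd (i , (ιa₀⇝p , p⇝ιa₀) , q-unlinked) = Sum.[ forward , backward ]′ (orientation-arc oR (step i))
        where
        q = vert (suc i)
        forward : (vert (inject₁ i) , q) ∈ D → ⊥
        forward pq∈D = let b , q⇝ιb = reaches-image q in linked-or-pair b q⇝ιb (b ≟ a₀)
          where
          ιa₀⇝q = reaches-trans ιa₀⇝p (reaches-arc pq∈D)
          linked-or-pair : ∀ b → Reaches D q (ι b) → Dec (b ≡ a₀) → ⊥
          linked-or-pair b q⇝ιb (yes refl) = q-unlinked (ιa₀⇝q , q⇝ιb)
          linked-or-pair b q⇝ιb (no b≢a₀)  = no-pair (b , a₀ , b≢a₀ , reaches-trans ιa₀⇝q q⇝ιb)
        backward : (q , vert (inject₁ i)) ∈ D → ⊥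
        backward qp∈D = let a , ιa⇝q = reached-from-image q in linked-or-pair a ιa⇝q (a ≟ a₀)
          where
          q⇝ιa₀ = reaches-trans (reaches-arc qp∈D) p⇝ιa₀
          linked-or-pair : ∀ a → Reaches D (ι a) q → Dec (a ≡ a₀) → ⊥
          linked-or-pair a ιa⇝q (yes refl) = q-unlinked (ιa⇝q , q⇝ιa₀)
          linked-or-pair a ιa⇝q (no a≢a₀)  = no-pair (a₀ , a , a≢a₀ ∘ ≡.sym , reaches-trans ιa⇝q q⇝ιa₀)

-- Hamiltonian paths

pathArc : ∀ {n} {x y : Fin n} (P : HamPath n x y) → Fin (HamPath.len P) → Edge n
pathArc P i = vert (inject₁ i) , vert (suc i)
  where open HamPath P

pathArcs : ∀ {n} {x y : Fin n} → HamPath n x y → List (Edge n)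
pathArcs P = List.tabulate (pathArc P)

pathArcs-orientation : ∀ {n} {x y : Fin n} (P : HamPath n x y) → IsOrientation (pathEdges P) (pathArcs P)
pathArcs-orientation P = Pointwise.tabulate⁺ (Joins-as-arc ∘ HamPath.joins P)

Enters-complement : ∀ {n} {S : Fin n → Bool} {d} → Enters (not ∘ S) d → Leaves S d
Enters-complement (¬Sx≡false , ¬Sy≡true) = not-injective ¬Sx≡false , not-injective ¬Sy≡true

module _ {h n} {ι : Fin h → Fin n} {a b : Fin h} (P : HamPath h a b) {T : List (Edge n)}
         (path-in-T : ∀ i → mapEdge ι (pathArc P i) ∈ T) (back : Reaches T (ι b) (ι a))
         (cuts : UniformCutsCrossed ι T) where

  open HamPath P

  private
    along : ∀ {S s} → ∃ (Flip (S ∘ ι ∘ vert) s) → Any (Crossing s S) T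
    along (i , crossingᵢ) = lose (path-in-T i) crossingᵢ

    ends-apart : ∀ S s → S (ι a) ≡ s → S (ι b) ≡ not s → Any (Crossing s S) T
    ends-apart S s Sa Sb = along (flip-before (S ∘ ι ∘ vert) s (≡.trans (cong (S ∘ ι) start) Sa)
                                              (≡.trans (cong (S ∘ ι) end) Sb))

    ends-together : ∀ S s → S (ι a) ≡ s → S (ι b) ≡ s →
      (∃[ v ] S v ≡ true) → (∃[ v ] S v ≡ false) → Crossed S T
    ends-together S s Sa Sb inside outside with FinP.all? (λ c → S (ι c) Bool.≟ s)
    ... | yes uniform = cuts S (λ c d → ≡.trans (uniform c) (≡.sym (uniform d))) inside outside
    ... | no ¬uniform =
      let c , Sc≢s = FinP.¬∀⟶∃¬ h _ (λ c → S (ι c) Bool.≟ s) ¬uniform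
          j , vertj≡c = position vbij c
          Sj≡¬s = ≡.trans (cong (S ∘ ι) vertj≡c) (¬-not Sc≢s)
      in crossed s
           (along (flip-before (S ∘ ι ∘ vert) s (≡.trans (cong (S ∘ ι) start) Sa) Sj≡¬s))
           (along (flip-after (S ∘ ι ∘ vert) (not s) Sj≡¬s
                     (≡.trans (cong (S ∘ ι) end) (≡.trans Sb (≡.sym (not-involutive s))))))

  path-extension-stronglyConnected : IsStronglyConnected T
  path-extension-stronglyConnected S inside outside with S (ι a) in Sa | S (ι b) in Sb
  ... | true  | false = ends-apart S true Sa Sb , back S Sb Sa
  ... | false | true  = Any.map (Enters-complement {S = S}) (back (not ∘ S) (cong not Sb) (cong not Sa)) ,
                        ends-apart S false Sa Sb
  ... | true  | true  = ends-together S true Sa Sb inside outside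
  ... | false | false = ends-together S false Sa Sb inside outside

module PathExtension
  {k h n r} (2∤k : ¬ 2 ℕ∣.∣ k) {H : Graph h} {ι : Fin h → Fin n} (ι-injective : Injective _≡_ _≡_ ι)
  {R : Graph n} {β : Fin n → ℤ} (β≡deg : ∀ v → + 2 ℤ∣.∣ (β v - + deg (List.map (mapEdge ι) H ++ R) v))
  {π : Fin n → Fin (suc r)} (contraction : IsContractionMap ι π)
  {β′ : Fin (suc r) → ℤ} (β′≡Σβ : + (2 ℕ.* k) ℤ∣.∣ (β′ zero - Σℤ (λ a → β (ι a))))
  (β′≡β : ∀ v → π v ≢ zero → β′ (π v) ≡ β v)
  {D′ : List (Edge (suc r))} (D′≡β′ : Mod2k k β′ D′)
  {DR : List (Edge n)} (oR : IsOrientation R DR) (DR↦D′ : contractEdges π DR ≡ D′)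
  {a b : Fin h} (P : HamPath h a b) {RH : Graph h} (H↭P+RH : H ↭ pathEdges P ++ RH) (szRH : SZ k RH)
  where

  open Contraction ι-injective contraction

  instance
    k≢0 : NonZero k
    k≢0 = odd⇒nonZero 2∤k

  -- What the orientation of H has to contribute at each vertex of H.
  γ : Fin h → ℤ
  γ c = β (ι c) - net DR (ι c)

  Σγ≡0 : Σℤ γ ≡ + 0 mod k
  Σγ≡0 = ≡-mod-∣ (ℕ∣.n∣m*n 2) (begin
    Σℤ γ
      ≡⟨ Σℤ-- (β ∘ ι) (net DR ∘ ι) ⟩
    Σℤ (β ∘ ι) - Σℤ (net DR ∘ ι)
      ≡⟨ cong (_-_ (Σℤ (β ∘ ι))) (Σℤ-net-inside DR) ⟩
    Σℤ (β ∘ ι) - net (contractEdges π DR) zero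
      ≡⟨ cong (λ Y → Σℤ (β ∘ ι) - net Y zero) DR↦D′ ⟩
    Σℤ (β ∘ ι) - net D′ zero
      ≈⟨ -‿cong-mod (≡-mod-sym (∣ᵤ⇒≡-mod (β′ zero) _ β′≡Σβ)) (∣ᵤ⇒≡-mod _ _ (D′≡β′ zero)) ⟩
    β′ zero - β′ zero
      ≡⟨ ℤP.+-inverseʳ (β′ zero) ⟩
    + 0 ∎)
    where open mod-Reasoning (2 ℕ.* k)

  extension : ∃[ DH ] ∃[ DRH ] (IsOrientation H DH × DH ↭ pathArcs P ++ DRH × ∀ c → net DH c ≡ γ c mod k)
  extension = SZ-extend szRH H↭P+RH (pathArcs-orientation P) γ Σγ≡0

  DH : List (Edge h)
  DH = proj₁ extension
  oH : IsOrientation H DH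
  oH = proj₁ (proj₂ (proj₂ extension))
  DH↭P+DRH : DH ↭ pathArcs P ++ proj₁ (proj₂ extension)
  DH↭P+DRH = proj₁ (proj₂ (proj₂ (proj₂ extension)))
  netDH≡γ : ∀ c → net DH c ≡ γ c mod k
  netDH≡γ = proj₂ (proj₂ (proj₂ (proj₂ extension)))

  T : List (Edge n)
  T = List.map (mapEdge ι) DH ++ DR

  oT : IsOrientation (List.map (mapEdge ι) H ++ R) T
  oT = Pointwise.++⁺ (map-orientation ι oH) oR

  net-inside : ∀ c → net T (ι c) ≡ β (ι c) mod k
  net-inside c = begin
    net T (ι c)
      ≡⟨ net-++ (List.map (mapEdge ι) DH) DR (ι c) ⟩
    net (List.map (mapEdge ι) DH) (ι c) + net DR (ι c)
      ≡⟨ cong (λ x → x + net DR (ι c)) (net-map ι (λ u → δ-injective ι-injective u c) DH) ⟩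
    net DH c + net DR (ι c)
      ≈⟨ +-congʳ-mod (net DR (ι c)) (netDH≡γ c) ⟩
    γ c + net DR (ι c)
      ≡⟨ cancel (β (ι c)) (net DR (ι c)) ⟩
    β (ι c) ∎
    where
    open mod-Reasoning k
    cancel : ∀ x d → (x - d) + d ≡ x
    cancel = solve-∀

  net-outside-image : ∀ v → π v ≢ zero → net T v ≡ β v mod (2 ℕ.* k)
  net-outside-image v πv≢0 = begin
    net T v
      ≡⟨ net-++ (List.map (mapEdge ι) DH) DR v ⟩
    net (List.map (mapEdge ι) DH) v + net DR v
      ≡⟨ cong (λ x → x + net DR v) (net-map-∉ ι ι≢v DH) ⟩
    + 0 + net DR v
      ≡⟨ ℤP.+-identityˡ (net DR v) ⟩
    net DR v
      ≡⟨ ≡.trans (net-outside DR πv≢0) (cong (λ Y → net Y (π v)) DR↦D′) ⟩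
    net D′ (π v)
      ≈⟨ ∣ᵤ⇒≡-mod _ _ (D′≡β′ (π v)) ⟩
    β′ (π v)
      ≡⟨ β′≡β v πv≢0 ⟩
    β v ∎
    where
    open mod-Reasoning (2 ℕ.* k)
    ι≢v : ∀ c → ι c ≢ v
    ι≢v c ιc≡v = πv≢0 (≡.trans (cong π (≡.sym ιc≡v)) (π∘ι≡zero c))

  T-mod2k : Mod2k k β T
  T-mod2k v = ≡-mod⇒∣ᵤ (by-cases (π v ≟ zero))
    where
    by-cases : Dec (π v ≡ zero) → net T v ≡ β v mod (2 ℕ.* k)
    by-cases (yes πv≡0) = let c , ιc≡v = fibre-of-zero v πv≡0 in
      ≡.subst (λ w → net T w ≡ β w mod (2 ℕ.* k)) ιc≡v
        (net≡pc-boundary {β = β} 2∤k oT (ι c) (β≡deg (ι c)) (net-inside c))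
    by-cases (no πv≢0) = net-outside-image v πv≢0

  path-in-T : ∀ i → mapEdge ι (pathArc P i) ∈ T
  path-in-T i = AnyP.++⁺ˡ (∈-map⁺ (mapEdge ι)
    (PermP.Any-resp-↭ (↭.↭-sym DH↭P+DRH) (AnyP.++⁺ˡ (AnyP.tabulate⁺ {f = pathArc P} i refl))))

hamPaths-W : ∀ {k h} {H : Graph h} → ¬ 2 ℕ∣.∣ k →
  (∀ (x y : Fin h) → x ≢ y → ∃[ P ] ∃[ R ] (H ↭ pathEdges {h} {x} {y} P ++ R × SZ k R)) → W k H
hamPaths-W {k} {h} {H} 2∤k paths n ι ι-injective R _ (a₀ , b₀ , a₀≢b₀ , route)
           β (_ , β≡deg , _) r π contraction β′ (_ , β′≡Σβ , β′≡β) D′ oD′ strongD′ D′≡β′ =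
  from-lift (lift-orientation π R D′ oD′)
  where
  Extension : Set
  Extension = ∃[ DH ] ∃[ DR ]
    (IsOrientation (List.map (mapEdge ι) H) DH × IsOrientation R DR × contractEdges π DR ≡ D′ ×
     IsStronglyConnected (DH ++ DR) × Mod2k k β (DH ++ DR))
  from-lift : ∃[ DR ] (IsOrientation R DR × contractEdges π DR ≡ D′) → Extension
  from-lift (DR , oR , DR↦D′) = from-pair (reachable-pair cuts a₀ oR a₀≢b₀ route)
    where
    cuts : UniformCutsCrossed ι DR
    cuts = Contraction.uniform-cuts-crossed ι-injective contraction
             (≡.subst IsStronglyConnected (≡.sym DR↦D′) strongD′)
    from-pair : ReachablePair ι DR → Extension
    from-pair (a , b , a≢b , ιb⇝ιa) = from-path (paths a b a≢b)
      where
      from-path : ∃[ P ] ∃[ RH ] (H ↭ pathEdges {h} {a} {b} P ++ RH × SZ k RH) → Extension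
      from-path (P , RH , H↭P+RH , szRH) =
        List.map (mapEdge ι) DH , DR , map-orientation ι oH , oR , DR↦D′ ,
        path-extension-stronglyConnected P path-in-T (reaches-++ _ ιb⇝ιa) (uniformCutsCrossed-++ _ cuts) ,
        T-mod2k
        where open PathExtension 2∤k ι-injective β≡deg contraction β′≡Σβ β′≡β D′≡β′ oR DR↦D′ P H↭P+RH szRH

proposition2p12 : ∀ (k : ℕ) → 1 ≤ k →
    (∀ {n} (G : Graph n) → Loopless G →
      (C : HamCycle n) (R : Graph n) → G ↭ (cycleEdges C ++ R) → SZ k R →
      SC k G)
    ×
    (∀ {n} (G : Graph n) → Loopless G →
      (∀ (x y : Fin n) → x ≢ y →
        ∃[ P ] ∃[ R ] (G ↭ (pathEdges {n} {x} {y} P ++ R) × SZ k R)) →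
      W k G)
proposition2p12 k 1≤k = cycle-part , path-part
  where
  cycle-part : ∀ {n} (G : Graph n) → Loopless G → (C : HamCycle n) (R : Graph n) →
    G ↭ (cycleEdges C ++ R) → SZ k R → SC k G
  cycle-part G _ C R G↭C+R szR =
    hamCycle-SC C R (SZ⇒odd 1≤k (hamCycle-distinct C) szR) G↭C+R szR
  path-part : ∀ {n} (G : Graph n) → Loopless G →
    (∀ (x y : Fin n) → x ≢ y → ∃[ P ] ∃[ R ] (G ↭ (pathEdges {n} {x} {y} P ++ R) × SZ k R)) →
    W k G
  path-part G _ paths n ι ι-injective R loopless nice@(a₀ , b₀ , a₀≢b₀ , _) =
    let _ , _ , _ , szR = paths a₀ b₀ a₀≢b₀
    in hamPaths-W (SZ⇒odd 1≤k a₀≢b₀ szR) paths n ι ι-injective R loopless nice
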